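{- Let $\Theta$ be a branch of a tableau of $\mathbf{TAB}_{\mathbf{IB}}$. Then $\Theta$ is infinite if and only if there is an infinite sequence of nominals $i_0\prec_\Theta i_1\prec_\Theta i_2\prec_\Theta\cdots$.
   Context: Hybrid language: fix disjoint countably infinite sets $\mathbf{Prop}$ (propositional variables) and $\mathbf{Nom}$ (nominals). Formulas: $\varphi ::= p \mid i \mid \neg\varphi \mid \varphi\land\varphi \mid \diamondsuit\varphi \mid @_i\varphi$ with $p\in\mathbf{Prop}$, $i\in\mathbf{Nom}$; $\square\varphi$ abbreviates $\neg\diamondsuit\neg\varphi$. Tableaux of $\mathbf{TAB}_{\mathbf{IB}}$: a tableau is a well-founded tree of formulas of the form $@_i\varphi$, started from a root formula $@_i\varphi$ where $i$ does not occur in $\varphi$. Each branch (maximal path) is extended by applying the rules below as often as possible, except that nothing more is added to a branch once it is closed, or once every formula that any rule could generate already occurs on it. A branch $\Theta$ is closed if $@_i\varphi, @_i\neg\varphi\in\Theta$ for some $i,\varphi$. Rules (premises already on the branch, conclusions added to it): [$\neg\neg$] from $@_i\neg\neg\varphi$ add $@_i\varphi$; [$\land$] from $@_i(\varphi\land\psi)$ add $@_i\varphi$ and $@_i\psi$; [$\neg\land$] from $@_i\neg(\varphi\land\psi)$ split the branch into one branch with $@_i\neg\varphi$ and one with $@_i\neg\psi$; [$\diamondsuit$] from $@_i\diamondsuit\varphi$ add $@_i\diamondsuit j$ and $@_j\varphi$, where $j$ is a nominal not yet occurring on the branch, the rule is applied at most once per formula, the premise is not an accessibility formula, and (restriction $\mathcal{D}$)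 $i$ is a quasi-urfather on the branch; [$\neg\diamondsuit$] from $@_i\neg\diamondsuit\varphi$ and $@_i\diamondsuit j$ add $@_j\neg\varphi$; [$@$] from $@_i@_j\varphi$ add $@_j\varphi$; [$\neg@$] from $@_i\neg@_j\varphi$ add $@_j\neg\varphi$; [$\mathit{Id}$] from $@_i\varphi$ and $@_i j$ add $@_j\varphi$, provided $@_i\varphi$ is not an accessibility formula; [$\mathit{Ref}$] add $@_i i$ for any nominal $i$ occurring on the branch; [$\square_{\mathit{sym}}$] from $@_i\square\varphi$ and $@_j\diamondsuit i$ add $@_j\varphi$; ($\mathcal{I}$) for every nominal $i$ occurring on the branch add $@_i\neg\diamondsuit i$. An accessibility formula is a formula $@_i\diamondsuit j$ added by [$\diamondsuit$] with $j$ new. Auxiliary notions for a branch $\Theta$: $@_i\varphi$ is a quasi-subformula of $@_j\psi$ if $\varphi$ is a subformula of $\psi$, or $\varphi=\neg\chi$ with $\chi$ a subformula of $\psi$. $T^\Theta(i)=\{\varphi \mid @_i\varphi\in\Theta$ and $@_i\varphi$ is a quasi-subformula of the root formula$\}$. Nominals $i,j$ are twins in $\Theta$ if $T^\Theta(i)=T^\Theta(j)$. $i\prec_\Theta j$ if $j$ was introduced by applying [$\diamondsuit$] to a formula $@_i\diamondsuit\varphi$; $\prec_\Theta^*$ is its reflexive transitive closure. A nominal $i$ is a quasi-urfather on $\Theta$ if there are no twins $j\neq k$ with $j\prec_\Theta^* i$ and $k\prec_\Theta^* i$. -}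

module Defs where

open import Data.Nat using (ℕ; zero; suc)
open import Data.List using (List; []; _∷_; _++_; [_])
open import Data.List.Membership.Propositional using (_∈_; _∉_)
open import Data.List.Relation.Unary.Any using (Any)
open import Data.List.Relation.Unary.All using (All)
open import Data.Product using (Σ; ∃; ∃-syntax; _×_; _,_)
open import Data.Sum using (_⊎_)
open import Relation.Nullary using (¬_)
open import Relation.Binary.PropositionalEquality using (_≡_; _≢_)
open import Relation.Binary.Construct.Closure.ReflexiveTransitive using (Star)

Nom : Set
Nom = ℕ

PropVar : Set
PropVar = ℕ

infixr 7 ~_ ◇_
infixr 6 _∧_

data Form : Set where
  prop : PropVar → Form
  nom  : Nom → Form
  ~_   : Form → Form
  _∧_  : Form → Form → Form
  ◇_   : Form → Form
  at   : Nom → Form → Form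

□_ : Form → Form
□ φ = ~ ◇ ~ φ

data OccursIn (i : Nom) : Form → Set where
  o-nom : OccursIn i (nom i)
  o-~   : ∀ {φ} → OccursIn i φ → OccursIn i (~ φ)
  o-∧ˡ  : ∀ {φ ψ} → OccursIn i φ → OccursIn i (φ ∧ ψ)
  o-∧ʳ  : ∀ {φ ψ} → OccursIn i ψ → OccursIn i (φ ∧ ψ)
  o-◇   : ∀ {φ} → OccursIn i φ → OccursIn i (◇ φ)
  o-atˡ : ∀ {φ} → OccursIn i (at i φ)
  o-atʳ : ∀ {j φ} → OccursIn i φ → OccursIn i (at j φ)

data _⊑_ : Form → Form → Set where
  ⊑-refl : ∀ {φ} → φ ⊑ φ
  ⊑-~    : ∀ {φ ψ} → φ ⊑ ψ → φ ⊑ (~ ψ)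
  ⊑-∧ˡ   : ∀ {φ ψ χ} → φ ⊑ ψ → φ ⊑ (ψ ∧ χ)
  ⊑-∧ʳ   : ∀ {φ ψ χ} → φ ⊑ χ → φ ⊑ (ψ ∧ χ)
  ⊑-◇    : ∀ {φ ψ} → φ ⊑ ψ → φ ⊑ (◇ ψ)
  ⊑-at   : ∀ {φ ψ j} → φ ⊑ ψ → φ ⊑ (at j ψ)

-- Tableau formulas: a formula of the form @_i φ is represented by (i , φ).

TF : Set
TF = Nom × Form

QuasiSub : Form → Form → Set
QuasiSub φ ψ = (φ ⊑ ψ) ⊎ (∃[ χ ] (φ ≡ ~ χ × χ ⊑ ψ))

-- State of a branch after finitely many rule applications:
--   forms : the formulas on the branch so far
--   edges : pairs (i , j) such that j was introduced by [◇] applied to a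
--           formula @_i ◇ φ   (this is  i ≺ j)
--   used  : premises to which [◇] has already been applied
record State : Set where
  constructor ⟨_,_,_⟩
  field
    forms : List TF
    edges : List (Nom × Nom)
    used  : List TF
open State public

init : TF → State
init root = ⟨ [ root ] , [] , [] ⟩

module _ (s : State) where

  OccursOn : Nom → Set
  OccursOn i = Any (λ x → (Data.Product.proj₁ x ≡ i) ⊎ OccursIn i (Data.Product.proj₂ x)) (forms s)

  -- accessibility formula: @_i ◇ j added by [◇] with j new
  Acc : TF → Set
  Acc (i , φ) = ∃[ j ] (φ ≡ ◇ nom j × (i , j) ∈ edges s)

  Closed : Set
  Closed = ∃[ i ] ∃[ φ ] ((i , φ) ∈ forms s × (i , ~ φ) ∈ forms s)

  _≺ₛ_ : Nom → Nom → Set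
  i ≺ₛ j = (i , j) ∈ edges s

  T : TF → Nom → Form → Set
  T (r , ψ) i φ = (i , φ) ∈ forms s × QuasiSub φ ψ

  Twins : TF → Nom → Nom → Set
  Twins root i j = ∀ φ → (T root i φ → T root j φ) × (T root j φ → T root i φ)

  QuasiUrfather : TF → Nom → Set
  QuasiUrfather root i =
    ¬ (∃[ j ] ∃[ k ] (j ≢ k × Star _≺ₛ_ j i × Star _≺ₛ_ k i × Twins root j k))

  -- An instance is given by its
  -- list of alternatives (two for the branching rule [¬∧], one otherwise);
  -- each alternative is the list of conclusions added to the branch.
  data Inst : List (List TF) → Set where
    r-¬¬  : ∀ {i φ} → (i , ~ ~ φ) ∈ forms s → Inst [ [ (i , φ) ] ]
    r-∧   : ∀ {i φ ψ} → (i , φ ∧ ψ) ∈ forms s →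
            Inst [ (i , φ) ∷ (i , ψ) ∷ [] ]
    r-¬∧  : ∀ {i φ ψ} → (i , ~ (φ ∧ ψ)) ∈ forms s →
            Inst ([ (i , ~ φ) ] ∷ [ (i , ~ ψ) ] ∷ [])
    r-¬◇  : ∀ {i j φ} → (i , ~ ◇ φ) ∈ forms s → (i , ◇ nom j) ∈ forms s →
            Inst [ [ (j , ~ φ) ] ]
    r-at   : ∀ {i j φ} → (i , at j φ) ∈ forms s → Inst [ [ (j , φ) ] ]
    r-¬at  : ∀ {i j φ} → (i , ~ at j φ) ∈ forms s → Inst [ [ (j , ~ φ) ] ]
    r-Id  : ∀ {i j φ} → (i , φ) ∈ forms s → (i , nom j) ∈ forms s →
            ¬ Acc (i , φ) → Inst [ [ (j , φ) ] ]
    r-Ref : ∀ {i} → OccursOn i → Inst [ [ (i , nom i) ] ]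
    r-□sym : ∀ {i j φ} → (i , □ φ) ∈ forms s → (j , ◇ nom i) ∈ forms s →
            Inst [ [ (j , φ) ] ]
    r-I   : ∀ {i} → OccursOn i → Inst [ [ (i , ~ ◇ nom i) ] ]

  Present : List TF → Set
  Present L = All (_∈ forms s) L

  DiaApplicable : TF → Nom → Form → Set
  DiaApplicable root i φ =
    (i , ◇ φ) ∈ forms s × (i , ◇ φ) ∉ used s × ¬ Acc (i , ◇ φ) ×
    QuasiUrfather root i

-- One rule application (on a branch: for [¬∧] one alternative is chosen).
-- A rule is only applied if it adds something, i.e. no alternative of the
-- instance is already present on the branch.
data Step (root : TF) (s : State) : State → Set where
  plain : ∀ {alts L} → Inst s alts → All (λ A → ¬ Present s A) alts →
          L ∈ alts → Step root s ⟨ forms s ++ L , edges s , used s ⟩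
  dia   : ∀ {i j φ} → DiaApplicable s root i φ → ¬ OccursOn s j →
          Step root s ⟨ forms s ++ ((i , ◇ nom j) ∷ (j , φ) ∷ []) ,
                        edges s ++ [ (i , j) ] ,
                        used s ++ [ (i , ◇ φ) ] ⟩

Terminal : TF → State → Set
Terminal root s = Closed s ⊎ (∀ s' → ¬ Step root s s')

-- A branch of a TAB_IB tableau with root formula `root`, given as the
-- sequence of its stages.  Fairness ("rules applied as often as possible"):
-- every rule instance arising at some stage is eventually fulfilled.
record Branch (root : TF) : Set where
  field
    st    : ℕ → State
    start : st 0 ≡ init root
    next  : ∀ n → (¬ Closed (st n) × Step root (st n) (st (suc n)))
                ⊎ (Terminal root (st n) × st (suc n) ≡ st n)
    fair-plain : ∀ n alts → Inst (st n) alts →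
                 ∃[ m ] (Any (Present (st m)) alts ⊎ Closed (st m))
    fair-dia   : ∀ n i φ → DiaApplicable (st n) root i φ →
                 ∃[ m ] ((i , ◇ φ) ∈ used (st m) ⊎ Closed (st m)
                         ⊎ ¬ QuasiUrfather (st m) root i)
open Branch public

module _ {root : TF} (Θ : Branch root) where

  InBranch : TF → Set
  InBranch x = ∃[ n ] (x ∈ forms (st Θ n))

  Infinite : Set
  Infinite = ∀ (L : List TF) → ∃[ x ] (InBranch x × x ∉ L)

  _≺_ : Nom → Nom → Set
  i ≺ j = ∃[ n ] ((i , j) ∈ edges (st Θ n))

  InfiniteChain : Set
  InfiniteChain = Σ (ℕ → Nom) (λ f → ∀ n → f n ≺ f (suc n))

{-# OPTIONS --safe #-}
-- Both sides of the equivalence are refuted: every branch is finite and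
-- carries no infinite ≺-chain.  Each nominal on a branch gets a code, a
-- word over the subformulas and nominals of the root: a nominal k of the
-- root is coded by [ nom k ], and the nominal j created by [◇] from @_i ◇ψ
-- by ψ ∷ code i.  Since [◇] is applied at most once per premise, codes are
-- injective.  The length of code i is the number of ≺*-ancestors of i;
-- by restriction 𝒟 these are pairwise not twins, so there are at most as
-- many of them as there are possible T-sets.  Hence codes are bounded
-- words: no ≺-chain is longer than that bound, there are boundedly many
-- nominals, and every formula on the branch is @_k χ with χ a
-- quasi-subformula of the root or one of four formulas built from a
-- single nominal.
module Submission where

open import Defs
open import Data.Bool as Bool using (Bool; true; false)
open import Data.Empty using (⊥-elim)
open import Data.List using (List; []; _∷_; _++_; [_]; map; length; concatMap; deduplicate)
import Data.List.Properties as List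
open import Data.List.Membership.Propositional using (_∈_; _∉_; find; lose)
open import Data.List.Membership.Propositional.Properties
  using (∈-++⁺ˡ; ∈-++⁺ʳ; ∈-++⁻; ∈-map⁺; ∈-concatMap⁺; ∈-concatMap⁻;
         ∈-deduplicate⁺; ∈-deduplicate⁻)
open import Data.List.Relation.Binary.Subset.Propositional using (_⊆_)
open import Data.List.Relation.Unary.Any as Any using (here; there; index; _─_)
import Data.List.Relation.Unary.Any.Properties as Anyₚ
open import Data.List.Relation.Unary.All as All using (All; []; _∷_)
open import Data.List.Relation.Unary.AllPairs using ([]; _∷_)
open import Data.List.Relation.Unary.Unique.Propositional using (Unique)
import Data.List.Relation.Unary.Unique.DecPropositional.Properties as UniqueDec
open import Data.Nat
  using (ℕ; zero; suc; _+_; _*_; _≤_; _<_; _≤′_; ≤′-refl; ≤′-step; z≤n; s≤s; _⊔_)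
import Data.Nat.Properties as ℕ
open import Data.Product using (∃-syntax; _×_; _,_; proj₁; proj₂)
open import Data.Product.Properties using (≡-dec)
open import Data.Sum using (_⊎_; inj₁; inj₂; map₂)
open import Function using (id; _∘_)
open import Function.Bundles using (_⇔_; mk⇔)
open import Relation.Binary.Construct.Closure.ReflexiveTransitive as Star using (Star; ε; _◅_; _◅◅_)
open import Relation.Binary.Definitions using (DecidableEquality; Transitive)
open import Relation.Binary.PropositionalEquality hiding ([_])
open import Relation.Nullary using (¬_; yes; no)
open import Relation.Nullary.Decidable using (isYes; map′; _×-dec_; toWitness; fromWitness)

infix 4 _≟ᶠ_ _≟ᵗ_

_≟ᶠ_ : DecidableEquality Form
prop p ≟ᶠ prop p′   = map′ (cong prop) (λ { refl → refl }) (p ℕ.≟ p′)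
nom i ≟ᶠ nom i′     = map′ (cong nom) (λ { refl → refl }) (i ℕ.≟ i′)
(~ φ) ≟ᶠ (~ φ′)     = map′ (cong ~_) (λ { refl → refl }) (φ ≟ᶠ φ′)
(φ ∧ ψ) ≟ᶠ (φ′ ∧ ψ′) =
  map′ (λ (e , e′) → cong₂ _∧_ e e′) (λ { refl → refl , refl }) (φ ≟ᶠ φ′ ×-dec ψ ≟ᶠ ψ′)
(◇ φ) ≟ᶠ (◇ φ′)     = map′ (cong ◇_) (λ { refl → refl }) (φ ≟ᶠ φ′)
at i φ ≟ᶠ at i′ φ′  =
  map′ (λ (e , e′) → cong₂ at e e′) (λ { refl → refl , refl }) (i ℕ.≟ i′ ×-dec φ ≟ᶠ φ′)
prop _ ≟ᶠ nom _     = no λ ()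
prop _ ≟ᶠ ~ _       = no λ ()
prop _ ≟ᶠ _ ∧ _     = no λ ()
prop _ ≟ᶠ ◇ _       = no λ ()
prop _ ≟ᶠ at _ _    = no λ ()
nom _ ≟ᶠ prop _     = no λ ()
nom _ ≟ᶠ ~ _        = no λ ()
nom _ ≟ᶠ _ ∧ _      = no λ ()
nom _ ≟ᶠ ◇ _        = no λ ()
nom _ ≟ᶠ at _ _     = no λ ()
~ _ ≟ᶠ prop _       = no λ ()
~ _ ≟ᶠ nom _        = no λ ()
~ _ ≟ᶠ _ ∧ _        = no λ ()
~ _ ≟ᶠ ◇ _          = no λ ()
~ _ ≟ᶠ at _ _       = no λ ()
_ ∧ _ ≟ᶠ prop _     = no λ ()
_ ∧ _ ≟ᶠ nom _      = no λ ()
_ ∧ _ ≟ᶠ ~ _        = no λ ()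
_ ∧ _ ≟ᶠ ◇ _        = no λ ()
_ ∧ _ ≟ᶠ at _ _     = no λ ()
◇ _ ≟ᶠ prop _       = no λ ()
◇ _ ≟ᶠ nom _        = no λ ()
◇ _ ≟ᶠ ~ _          = no λ ()
◇ _ ≟ᶠ _ ∧ _        = no λ ()
◇ _ ≟ᶠ at _ _       = no λ ()
at _ _ ≟ᶠ prop _    = no λ ()
at _ _ ≟ᶠ nom _     = no λ ()
at _ _ ≟ᶠ ~ _       = no λ ()
at _ _ ≟ᶠ _ ∧ _     = no λ ()
at _ _ ≟ᶠ ◇ _       = no λ ()

_≟ᵗ_ : DecidableEquality TF
_≟ᵗ_ = ≡-dec ℕ._≟_ _≟ᶠ_

⊑-trans : Transitive _⊑_
⊑-trans p ⊑-refl   = p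
⊑-trans p (⊑-~ q)  = ⊑-~ (⊑-trans p q)
⊑-trans p (⊑-∧ˡ q) = ⊑-∧ˡ (⊑-trans p q)
⊑-trans p (⊑-∧ʳ q) = ⊑-∧ʳ (⊑-trans p q)
⊑-trans p (⊑-◇ q)  = ⊑-◇ (⊑-trans p q)
⊑-trans p (⊑-at q) = ⊑-at (⊑-trans p q)

subformulas : Form → List Form
subformulas (prop p) = [ prop p ]
subformulas (nom i)  = [ nom i ]
subformulas (~ φ)    = ~ φ ∷ subformulas φ
subformulas (φ ∧ ψ)  = φ ∧ ψ ∷ subformulas φ ++ subformulas ψ
subformulas (◇ φ)    = ◇ φ ∷ subformulas φ
subformulas (at i φ) = at i φ ∷ subformulas φ

⊑⇒∈subformulas : ∀ {χ φ} → χ ⊑ φ → χ ∈ subformulas φ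
⊑⇒∈subformulas {φ = prop _}  ⊑-refl = here refl
⊑⇒∈subformulas {φ = nom _}   ⊑-refl = here refl
⊑⇒∈subformulas {φ = ~ _}     ⊑-refl = here refl
⊑⇒∈subformulas {φ = _ ∧ _}   ⊑-refl = here refl
⊑⇒∈subformulas {φ = ◇ _}     ⊑-refl = here refl
⊑⇒∈subformulas {φ = at _ _}  ⊑-refl = here refl
⊑⇒∈subformulas (⊑-~ p)             = there (⊑⇒∈subformulas p)
⊑⇒∈subformulas (⊑-∧ˡ p)            = there (∈-++⁺ˡ (⊑⇒∈subformulas p))
⊑⇒∈subformulas (⊑-∧ʳ {ψ = ψ} p)    = there (∈-++⁺ʳ (subformulas ψ) (⊑⇒∈subformulas p))
⊑⇒∈subformulas (⊑-◇ p)             = there (⊑⇒∈subformulas p)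
⊑⇒∈subformulas (⊑-at p)            = there (⊑⇒∈subformulas p)

nominals : Form → List Nom
nominals (prop _) = []
nominals (nom i)  = [ i ]
nominals (~ φ)    = nominals φ
nominals (φ ∧ ψ)  = nominals φ ++ nominals ψ
nominals (◇ φ)    = nominals φ
nominals (at i φ) = i ∷ nominals φ

OccursIn⇒∈nominals : ∀ {k φ} → OccursIn k φ → k ∈ nominals φ
OccursIn⇒∈nominals o-nom              = here refl
OccursIn⇒∈nominals (o-~ o)            = OccursIn⇒∈nominals o
OccursIn⇒∈nominals (o-∧ˡ o)           = ∈-++⁺ˡ (OccursIn⇒∈nominals o)
OccursIn⇒∈nominals (o-∧ʳ {φ = φ} o)   = ∈-++⁺ʳ (nominals φ) (OccursIn⇒∈nominals o)
OccursIn⇒∈nominals (o-◇ o)            = OccursIn⇒∈nominals o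
OccursIn⇒∈nominals o-atˡ              = here refl
OccursIn⇒∈nominals (o-atʳ o)          = there (OccursIn⇒∈nominals o)

∈nominals⇒OccursIn : ∀ {k} φ → k ∈ nominals φ → OccursIn k φ
∈nominals⇒OccursIn (nom _) (here refl) = o-nom
∈nominals⇒OccursIn (~ φ) p = o-~ (∈nominals⇒OccursIn φ p)
∈nominals⇒OccursIn (φ ∧ ψ) p with ∈-++⁻ (nominals φ) p
... | inj₁ q = o-∧ˡ (∈nominals⇒OccursIn φ q)
... | inj₂ q = o-∧ʳ (∈nominals⇒OccursIn ψ q)
∈nominals⇒OccursIn (◇ φ) p = o-◇ (∈nominals⇒OccursIn φ p)
∈nominals⇒OccursIn (at _ _) (here refl) = o-atˡ
∈nominals⇒OccursIn (at _ φ) (there p) = o-atʳ (∈nominals⇒OccursIn φ p)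

∈-─⁺ : ∀ {A : Set} {x z} {ys : List A} (x∈ys : x ∈ ys) →
       z ∈ ys → z ≢ x → z ∈ (ys ─ x∈ys)
∈-─⁺ (here refl) (here refl) z≢x = ⊥-elim (z≢x refl)
∈-─⁺ (here refl) (there z∈ys) _  = z∈ys
∈-─⁺ (there _)   (here refl)  _  = here refl
∈-─⁺ (there x∈ys) (there z∈ys) z≢x = there (∈-─⁺ x∈ys z∈ys z≢x)

module _ {A : Set} where

  pigeonhole : ∀ {B : Set} (f : A → B) {xs ys} → Unique xs → (∀ {x} → x ∈ xs → f x ∈ ys) →
               (∀ {x y} → x ∈ xs → y ∈ xs → f x ≡ f y → x ≡ y) → length xs ≤ length ys
  pigeonhole f {[]} _ _ _ = z≤n
  pigeonhole f {x ∷ xs} {ys} (x∉xs ∷ unique) into injective = begin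
    suc (length xs)                      ≤⟨ s≤s (pigeonhole f unique into′ injective′) ⟩
    suc (length (ys ─ into (here refl))) ≡⟨ List.length-removeAt′ ys (index (into (here refl))) ⟨
    length ys                            ∎
    where
      open ℕ.≤-Reasoning
      injective′ : ∀ {y z} → y ∈ xs → z ∈ xs → f y ≡ f z → y ≡ z
      injective′ y∈ z∈ = injective (there y∈) (there z∈)
      into′ : ∀ {z} → z ∈ xs → f z ∈ (ys ─ into (here refl))
      into′ z∈xs = ∈-─⁺ (into (here refl)) (into (there z∈xs))
        (λ e → All.lookup x∉xs z∈xs (sym (injective (there z∈xs) (here refl) e)))

  words : ℕ → List A → List (List A)
  words zero    _  = [ [] ]
  words (suc n) as = [] ∷ concatMap (λ a → map (a ∷_) (words n as)) as

  ∈-words : ∀ n {as w} → All (_∈ as) w → length w ≤ n → w ∈ words n as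
  ∈-words zero    []            _         = here refl
  ∈-words (suc n) []            _         = here refl
  ∈-words (suc n) (a∈as ∷ w∈as) (s≤s len) =
    there (∈-concatMap⁺ (λ a → map (a ∷_) (words n _))
                        (lose a∈as (∈-map⁺ _ (∈-words n w∈as len))))

  map-≡⇒≡ : ∀ {B : Set} {f g : A → B} {xs x} → x ∈ xs → map f xs ≡ map g xs → f x ≡ g x
  map-≡⇒≡ (here refl) e = List.∷-injectiveˡ e
  map-≡⇒≡ (there x∈xs) e = map-≡⇒≡ x∈xs (List.∷-injectiveʳ e)

length-concatMap≤ : ∀ {A B : Set} (f : A → List B) {b} xs → (∀ x → length (f x) ≤ b) →
                    length (concatMap f xs) ≤ length xs * b
length-concatMap≤ f []       _ = z≤n
length-concatMap≤ f {b} (x ∷ xs) h = begin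
  length (f x ++ concatMap f xs)         ≡⟨ List.length-++ (f x) ⟩
  length (f x) + length (concatMap f xs) ≤⟨ ℕ.+-mono-≤ (h x) (length-concatMap≤ f xs h) ⟩
  b + length xs * b                      ∎
  where open ℕ.≤-Reasoning

update : ∀ {X : Set} → (Nom → X) → Nom → X → Nom → X
update f j v k with k ℕ.≟ j
... | yes _ = v
... | no  _ = f k

update-≡ : ∀ {X : Set} (f : Nom → X) j v → update f j v j ≡ v
update-≡ f j v with j ℕ.≟ j
... | yes _   = refl
... | no  j≢j = ⊥-elim (j≢j refl)

update-≢ : ∀ {X : Set} (f : Nom → X) j v {k} → k ≢ j → update f j v k ≡ f k
update-≢ f j v {k} k≢j with k ℕ.≟ j
... | yes k≡j = ⊥-elim (k≢j k≡j)
... | no  _   = refl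

Mentions : Nom → TF → Set
Mentions k x = proj₁ x ≡ k ⊎ OccursIn k (proj₂ x)

mentioned : TF → List Nom
mentioned (i , χ) = i ∷ nominals χ

Mentions⇒∈mentioned : ∀ {k} x → Mentions k x → k ∈ mentioned x
Mentions⇒∈mentioned _ (inj₁ refl) = here refl
Mentions⇒∈mentioned _ (inj₂ o)    = there (OccursIn⇒∈nominals o)

∈mentioned⇒Mentions : ∀ {k} x → k ∈ mentioned x → Mentions k x
∈mentioned⇒Mentions _       (here refl) = inj₁ refl
∈mentioned⇒Mentions (_ , χ) (there p)   = inj₂ (∈nominals⇒OccursIn χ p)

inst-introduces-no-nominal : ∀ {s alts L x k} → Inst s alts → L ∈ alts → x ∈ L →
                             Mentions k x → OccursOn s k
inst-introduces-no-nominal (r-¬¬ p) (here refl) (here refl) (inj₁ refl) = lose p (inj₁ refl)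
inst-introduces-no-nominal (r-¬¬ p) (here refl) (here refl) (inj₂ o) = lose p (inj₂ (o-~ (o-~ o)))
inst-introduces-no-nominal (r-∧ p) (here refl) (here refl) (inj₁ refl) = lose p (inj₁ refl)
inst-introduces-no-nominal (r-∧ p) (here refl) (here refl) (inj₂ o) = lose p (inj₂ (o-∧ˡ o))
inst-introduces-no-nominal (r-∧ p) (here refl) (there (here refl)) (inj₁ refl) = lose p (inj₁ refl)
inst-introduces-no-nominal (r-∧ p) (here refl) (there (here refl)) (inj₂ o) = lose p (inj₂ (o-∧ʳ o))
inst-introduces-no-nominal (r-¬∧ p) (here refl) (here refl) (inj₁ refl) = lose p (inj₁ refl)
inst-introduces-no-nominal (r-¬∧ p) (here refl) (here refl) (inj₂ (o-~ o)) = lose p (inj₂ (o-~ (o-∧ˡ o)))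
inst-introduces-no-nominal (r-¬∧ p) (there (here refl)) (here refl) (inj₁ refl) = lose p (inj₁ refl)
inst-introduces-no-nominal (r-¬∧ p) (there (here refl)) (here refl) (inj₂ (o-~ o)) =
  lose p (inj₂ (o-~ (o-∧ʳ o)))
inst-introduces-no-nominal (r-¬◇ p q) (here refl) (here refl) (inj₁ refl) = lose q (inj₂ (o-◇ o-nom))
inst-introduces-no-nominal (r-¬◇ p q) (here refl) (here refl) (inj₂ (o-~ o)) = lose p (inj₂ (o-~ (o-◇ o)))
inst-introduces-no-nominal (r-at p) (here refl) (here refl) (inj₁ refl) = lose p (inj₂ o-atˡ)
inst-introduces-no-nominal (r-at p) (here refl) (here refl) (inj₂ o) = lose p (inj₂ (o-atʳ o))
inst-introduces-no-nominal (r-¬at p) (here refl) (here refl) (inj₁ refl) = lose p (inj₂ (o-~ o-atˡ))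
inst-introduces-no-nominal (r-¬at p) (here refl) (here refl) (inj₂ (o-~ o)) = lose p (inj₂ (o-~ (o-atʳ o)))
inst-introduces-no-nominal (r-Id p q _) (here refl) (here refl) (inj₁ refl) = lose q (inj₂ o-nom)
inst-introduces-no-nominal (r-Id p q _) (here refl) (here refl) (inj₂ o) = lose p (inj₂ o)
inst-introduces-no-nominal (r-Ref o) (here refl) (here refl) (inj₁ refl) = o
inst-introduces-no-nominal (r-Ref o) (here refl) (here refl) (inj₂ o-nom) = o
inst-introduces-no-nominal (r-□sym p q) (here refl) (here refl) (inj₁ refl) = lose q (inj₁ refl)
inst-introduces-no-nominal (r-□sym p q) (here refl) (here refl) (inj₂ o) =
  lose p (inj₂ (o-~ (o-◇ (o-~ o))))
inst-introduces-no-nominal (r-I o) (here refl) (here refl) (inj₁ refl) = o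
inst-introduces-no-nominal (r-I o) (here refl) (here refl) (inj₂ (o-~ (o-◇ o-nom))) = o

record _≼_ (s s′ : State) : Set where
  constructor mk≼
  field
    forms-⊆ : forms s ⊆ forms s′
    edges-⊆ : edges s ⊆ edges s′
open _≼_

≼-refl : ∀ {s} → s ≼ s
≼-refl = mk≼ id id

≼-trans : ∀ {s s′ s″} → s ≼ s′ → s′ ≼ s″ → s ≼ s″
≼-trans (mk≼ fs es) (mk≼ fs′ es′) = mk≼ (fs′ ∘ fs) (es′ ∘ es)

step-≼ : ∀ {root s s′} → Step root s s′ → s ≼ s′
step-≼ (plain _ _ _) = mk≼ ∈-++⁺ˡ id
step-≼ (dia _ _)     = mk≼ ∈-++⁺ˡ ∈-++⁺ˡ

module Termination (r : Nom) (φ : Form) where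

  open import Data.List.Membership.DecPropositional _≟ᵗ_ using (_∈?_)

  root : TF
  root = r , φ

  -- [Id] never copies accessibility formulas, so a formula ◇ nom k that is
  -- not a subformula of φ only occurs at i along an edge i ≺ k.
  data Closure (E : List (Nom × Nom)) (i : Nom) : Form → Set where
    cl-sub  : ∀ {χ} → χ ⊑ φ → Closure E i χ
    cl-neg  : ∀ {χ} → χ ⊑ φ → Closure E i (~ χ)
    cl-nom  : ∀ {k} → Closure E i (nom k)
    cl-¬◇   : ∀ {k} → Closure E i (~ ◇ nom k)
    cl-¬nom : ∀ {k} → Closure E i (~ nom k)
    cl-acc  : ∀ {k} → (i , k) ∈ E → Closure E i (◇ nom k)

  Closure-mono : ∀ {E E′ i χ} → E ⊆ E′ → Closure E i χ → Closure E′ i χ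
  Closure-mono _ (cl-sub p) = cl-sub p
  Closure-mono _ (cl-neg p) = cl-neg p
  Closure-mono _ cl-nom     = cl-nom
  Closure-mono _ cl-¬◇      = cl-¬◇
  Closure-mono _ cl-¬nom    = cl-¬nom
  Closure-mono E⊆E′ (cl-acc e) = cl-acc (E⊆E′ e)

  InClosure : State → Set
  InClosure s = ∀ {i χ} → (i , χ) ∈ forms s → Closure (edges s) i χ

  inst-preserves-closure : ∀ {s alts L x} → InClosure s → Inst s alts → L ∈ alts → x ∈ L →
                           Closure (edges s) (proj₁ x) (proj₂ x)
  inst-preserves-closure cl (r-¬¬ p) (here refl) (here refl) with cl p
  ... | cl-sub q = cl-sub (⊑-trans (⊑-~ (⊑-~ ⊑-refl)) q)
  ... | cl-neg q = cl-sub (⊑-trans (⊑-~ ⊑-refl) q)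
  inst-preserves-closure cl (r-∧ p) (here refl) (here refl) with cl p
  ... | cl-sub q = cl-sub (⊑-trans (⊑-∧ˡ ⊑-refl) q)
  inst-preserves-closure cl (r-∧ p) (here refl) (there (here refl)) with cl p
  ... | cl-sub q = cl-sub (⊑-trans (⊑-∧ʳ ⊑-refl) q)
  inst-preserves-closure cl (r-¬∧ p) (here refl) (here refl) with cl p
  ... | cl-sub q = cl-neg (⊑-trans (⊑-~ (⊑-∧ˡ ⊑-refl)) q)
  ... | cl-neg q = cl-neg (⊑-trans (⊑-∧ˡ ⊑-refl) q)
  inst-preserves-closure cl (r-¬∧ p) (there (here refl)) (here refl) with cl p
  ... | cl-sub q = cl-neg (⊑-trans (⊑-~ (⊑-∧ʳ ⊑-refl)) q)
  ... | cl-neg q = cl-neg (⊑-trans (⊑-∧ʳ ⊑-refl) q)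
  inst-preserves-closure cl (r-¬◇ p _) (here refl) (here refl) with cl p
  ... | cl-sub q = cl-neg (⊑-trans (⊑-~ (⊑-◇ ⊑-refl)) q)
  ... | cl-neg q = cl-neg (⊑-trans (⊑-◇ ⊑-refl) q)
  ... | cl-¬◇    = cl-¬nom
  inst-preserves-closure cl (r-at p) (here refl) (here refl) with cl p
  ... | cl-sub q = cl-sub (⊑-trans (⊑-at ⊑-refl) q)
  inst-preserves-closure cl (r-¬at p) (here refl) (here refl) with cl p
  ... | cl-sub q = cl-neg (⊑-trans (⊑-~ (⊑-at ⊑-refl)) q)
  ... | cl-neg q = cl-neg (⊑-trans (⊑-at ⊑-refl) q)
  inst-preserves-closure cl (r-Id p _ ¬acc) (here refl) (here refl) with cl p
  ... | cl-sub q = cl-sub q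
  ... | cl-neg q = cl-neg q
  ... | cl-nom   = cl-nom
  ... | cl-¬◇    = cl-¬◇
  ... | cl-¬nom  = cl-¬nom
  ... | cl-acc e = ⊥-elim (¬acc (_ , refl , e))
  inst-preserves-closure cl (r-Ref _) (here refl) (here refl) = cl-nom
  inst-preserves-closure cl (r-□sym p _) (here refl) (here refl) with cl p
  ... | cl-sub q = cl-sub (⊑-trans (⊑-~ (⊑-◇ (⊑-~ ⊑-refl))) q)
  ... | cl-neg q = cl-sub (⊑-trans (⊑-◇ (⊑-~ ⊑-refl)) q)
  inst-preserves-closure cl (r-I _) (here refl) (here refl) = cl-¬◇

  quasiSubformulas : List Form
  quasiSubformulas = subformulas φ ++ map ~_ (subformulas φ)

  QuasiSub⇒∈quasiSubformulas : ∀ {χ} → QuasiSub χ φ → χ ∈ quasiSubformulas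
  QuasiSub⇒∈quasiSubformulas (inj₁ p) = ∈-++⁺ˡ (⊑⇒∈subformulas p)
  QuasiSub⇒∈quasiSubformulas (inj₂ (_ , refl , p)) =
    ∈-++⁺ʳ (subformulas φ) (∈-map⁺ ~_ (⊑⇒∈subformulas p))

  T-vector : State → Nom → List Bool
  T-vector s k = map (λ χ → isYes ((k , χ) ∈? forms s)) quasiSubformulas

  T-vector-≡⇒Twins : ∀ s {j k} → T-vector s j ≡ T-vector s k → Twins s root j k
  T-vector-≡⇒Twins s e χ = transfer e , transfer (sym e)
    where
      transfer : ∀ {j k} → T-vector s j ≡ T-vector s k → T s root j χ → T s root k χ
      transfer {j} {k} e (j∈ , qs) =
        toWitness {a? = (k , χ) ∈? forms s}
          (subst Bool.T (map-≡⇒≡ (QuasiSub⇒∈quasiSubformulas qs) e)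
            (fromWitness {a? = (j , χ) ∈? forms s} j∈)) ,
        qs

  T-vectors : List (List Bool)
  T-vectors = words (length quasiSubformulas) (true ∷ false ∷ [])

  ∈-T-vectors : ∀ s k → T-vector s k ∈ T-vectors
  ∈-T-vectors s k =
    ∈-words _ (All.tabulate (λ {b} _ → bool b)) (ℕ.≤-reflexive (List.length-map _ quasiSubformulas))
    where
      bool : ∀ b → b ∈ true ∷ false ∷ []
      bool true  = here refl
      bool false = there (here refl)

  DistinctAncestors : State → Nom → ℕ → Set
  DistinctAncestors s k n = ∃[ xs ] (Unique xs × All (λ x → Star (_≺ₛ_ s) x k) xs × length xs ≡ n)

  urfather-ancestors-bound : ∀ {s i n} → DistinctAncestors s i n → QuasiUrfather s root i →
                             n ≤ length T-vectors
  urfather-ancestors-bound {s} (xs , unique , ancestors , refl) urfather =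
    pigeonhole (T-vector s) unique (λ {x} _ → ∈-T-vectors s x) injective
    where
      injective : ∀ {x y} → x ∈ xs → y ∈ xs → T-vector s x ≡ T-vector s y → x ≡ y
      injective {x} {y} x∈ y∈ e with x ℕ.≟ y
      ... | yes x≡y = x≡y
      ... | no  x≢y = ⊥-elim (urfather (x , y , x≢y , All.lookup ancestors x∈ ,
                                        All.lookup ancestors y∈ , T-vector-≡⇒Twins s e))

  codeAlphabet : List Form
  codeAlphabet = map nom (r ∷ nominals φ) ++ subformulas φ

  maxCodeLength : ℕ
  maxCodeLength = suc (length T-vectors)

  CodeOrigin : State → (Nom → List Form) → Nom → Set
  CodeOrigin s code k =
    code k ≡ [ nom k ] ⊎ ∃[ ψ ] ∃[ i ] (code k ≡ ψ ∷ code i × OccursOn s i × (i , ◇ ψ) ∈ used s)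

  record WellFormed (s : State) : Set where
    field
      closure        : InClosure s
      edge-occurs    : ∀ {i j} → (i , j) ∈ edges s → OccursOn s i × OccursOn s j
      code           : Nom → List Form
      code-alphabet  : ∀ {k} → OccursOn s k → All (_∈ codeAlphabet) (code k)
      code-bounded   : ∀ {k} → OccursOn s k → length (code k) ≤ maxCodeLength
      code-origin    : ∀ {k} → OccursOn s k → CodeOrigin s code k
      code-injective : ∀ {j k} → OccursOn s j → OccursOn s k → code j ≡ code k → j ≡ k
      code-edge      : ∀ {i j} → (i , j) ∈ edges s → ∃[ ψ ] (code j ≡ ψ ∷ code i)
      ancestry       : ∀ {k} → OccursOn s k → DistinctAncestors s k (length (code k))

  module _ {s} (wf : WellFormed s) where
    open WellFormed wf

    code-nonempty : ∀ {k} → OccursOn s k → 0 < length (code k)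
    code-nonempty o with code-origin o
    ... | inj₁ e                 = subst (λ c → 0 < length c) (sym e) (s≤s z≤n)
    ... | inj₂ (_ , _ , e , _)   = subst (λ c → 0 < length c) (sym e) (s≤s z≤n)

    ancestor-occurs : ∀ {x k} → Star (_≺ₛ_ s) x k → OccursOn s k → OccursOn s x
    ancestor-occurs ε       o = o
    ancestor-occurs (e ◅ _) _ = proj₁ (edge-occurs e)

  wellFormed-init : WellFormed (init root)
  wellFormed-init = record
    { closure        = λ { (here refl) → cl-sub ⊑-refl }
    ; edge-occurs    = λ ()
    ; code           = λ k → [ nom k ]
    ; code-alphabet  = λ o → ∈-++⁺ˡ (∈-map⁺ nom (root-nominal o)) ∷ []
    ; code-bounded   = λ _ → s≤s z≤n
    ; code-origin    = λ _ → inj₁ refl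
    ; code-injective = λ { _ _ refl → refl }
    ; code-edge      = λ ()
    ; ancestry       = λ {k} _ → [ k ] , [] ∷ [] , ε ∷ [] , refl
    }
    where
      root-nominal : ∀ {k} → OccursOn (init root) k → k ∈ r ∷ nominals φ
      root-nominal (here (inj₁ refl)) = here refl
      root-nominal (here (inj₂ o))    = there (OccursIn⇒∈nominals o)

  module PlainStep {s alts L} (wf : WellFormed s) (inst : Inst s alts) (L∈alts : L ∈ alts) where
    open WellFormed wf

    s′ : State
    s′ = ⟨ forms s ++ L , edges s , used s ⟩

    occurs↑ : ∀ {k} → OccursOn s k → OccursOn s′ k
    occurs↑ = Anyₚ.++⁺ˡ

    occurs↓ : ∀ {k} → OccursOn s′ k → OccursOn s k
    occurs↓ o with Anyₚ.++⁻ (forms s) o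
    ... | inj₁ o′ = o′
    ... | inj₂ o′ = let _ , x∈L , m = find o′ in inst-introduces-no-nominal inst L∈alts x∈L m

    closure′ : InClosure s′
    closure′ x∈ with ∈-++⁻ (forms s) x∈
    ... | inj₁ x∈s = closure x∈s
    ... | inj₂ x∈L = inst-preserves-closure closure inst L∈alts x∈L

    wellFormed′ : WellFormed s′
    wellFormed′ = record
      { closure        = closure′
      ; edge-occurs    = λ e → let oi , oj = edge-occurs e in occurs↑ oi , occurs↑ oj
      ; code           = code
      ; code-alphabet  = code-alphabet ∘ occurs↓
      ; code-bounded   = code-bounded ∘ occurs↓
      ; code-origin    = λ o → map₂ (λ (ψ , i , e , oi , u) → ψ , i , e , occurs↑ oi , u)
                                     (code-origin (occurs↓ o))
      ; code-injective = λ oj ok → code-injective (occurs↓ oj) (occurs↓ ok)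
      ; code-edge      = code-edge
      ; ancestry       = ancestry ∘ occurs↓
      }

  module DiaStep {s i j ψ} (wf : WellFormed s)
    (i◇ψ∈s : (i , ◇ ψ) ∈ forms s) (unused : (i , ◇ ψ) ∉ used s) (¬acc : ¬ Acc s (i , ◇ ψ))
    (urfather : QuasiUrfather s root i) (j-fresh : ¬ OccursOn s j) where
    open WellFormed wf

    s′ : State
    s′ = ⟨ forms s ++ ((i , ◇ nom j) ∷ (j , ψ) ∷ []) ,
           edges s ++ [ (i , j) ] ,
           used s ++ [ (i , ◇ ψ) ] ⟩

    code′ : Nom → List Form
    code′ = update code j (ψ ∷ code i)

    i-occurs : OccursOn s i
    i-occurs = lose i◇ψ∈s (inj₁ refl)

    occurs↑ : ∀ {k} → OccursOn s k → OccursOn s′ k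
    occurs↑ = Anyₚ.++⁺ˡ

    j-occurs : OccursOn s′ j
    j-occurs = Anyₚ.++⁺ʳ (forms s) (there (here (inj₁ refl)))

    occurs↓ : ∀ {k} → OccursOn s′ k → OccursOn s k ⊎ k ≡ j
    occurs↓ o with Anyₚ.++⁻ (forms s) o
    ... | inj₁ o′                         = inj₁ o′
    ... | inj₂ (here (inj₁ refl))         = inj₁ i-occurs
    ... | inj₂ (here (inj₂ (o-◇ o-nom)))  = inj₂ refl
    ... | inj₂ (there (here (inj₁ refl))) = inj₂ refl
    ... | inj₂ (there (here (inj₂ o)))    = inj₁ (lose i◇ψ∈s (inj₂ (o-◇ o)))

    code′-old : ∀ {k} → OccursOn s k → code′ k ≡ code k
    code′-old o = update-≢ code j _ (λ { refl → j-fresh o })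

    code′-j : code′ j ≡ ψ ∷ code i
    code′-j = update-≡ code j _

    code′-new : code′ j ≡ ψ ∷ code′ i
    code′-new = trans code′-j (cong (ψ ∷_) (sym (code′-old i-occurs)))

    ψ⊑φ : ψ ⊑ φ
    ψ⊑φ with closure i◇ψ∈s
    ... | cl-sub p = ⊑-trans (⊑-◇ ⊑-refl) p
    ... | cl-acc e = ⊥-elim (¬acc (_ , refl , e))

    new-edge : (i , j) ∈ edges s′
    new-edge = ∈-++⁺ʳ (edges s) (here refl)

    closure′ : InClosure s′
    closure′ x∈ with ∈-++⁻ (forms s) x∈
    ... | inj₁ x∈s                = Closure-mono ∈-++⁺ˡ (closure x∈s)
    ... | inj₂ (here refl)        = cl-acc new-edge
    ... | inj₂ (there (here refl)) = cl-sub ψ⊑φ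

    edge-occurs′ : ∀ {k l} → (k , l) ∈ edges s′ → OccursOn s′ k × OccursOn s′ l
    edge-occurs′ e with ∈-++⁻ (edges s) e
    ... | inj₁ e′         = let ok , ol = edge-occurs e′ in occurs↑ ok , occurs↑ ol
    ... | inj₂ (here refl) = occurs↑ i-occurs , j-occurs

    -- the code of j is new since [◇] has not been applied to @_i ◇ψ before
    code-fresh : ∀ {k} → OccursOn s k → code k ≢ ψ ∷ code i
    code-fresh o e with code-origin o
    ... | inj₁ e′ =
          ℕ.<-irrefl (cong length (List.∷-injectiveʳ (trans (sym e′) e))) (code-nonempty wf i-occurs)
    ... | inj₂ (ψ′ , i′ , e′ , oi′ , u) with List.∷-injective (trans (sym e′) e)
    ...   | refl , same-code with code-injective oi′ i-occurs same-code
    ...     | refl = unused u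

    code′-fresh : ∀ {k} → OccursOn s k → code′ k ≢ code′ j
    code′-fresh o e = code-fresh o (trans (sym (code′-old o)) (trans e code′-j))

    code-injective′ : ∀ {k l} → OccursOn s′ k → OccursOn s′ l → code′ k ≡ code′ l → k ≡ l
    code-injective′ ok ol e with occurs↓ ok | occurs↓ ol
    ... | inj₁ ok′  | inj₁ ol′  =
          code-injective ok′ ol′ (trans (sym (code′-old ok′)) (trans e (code′-old ol′)))
    ... | inj₂ refl | inj₂ refl = refl
    ... | inj₁ ok′  | inj₂ refl = ⊥-elim (code′-fresh ok′ e)
    ... | inj₂ refl | inj₁ ol′  = ⊥-elim (code′-fresh ol′ (sym e))

    code-bounded-j : length (code′ j) ≤ maxCodeLength
    code-bounded-j = subst (_≤ maxCodeLength) (cong length (sym code′-j))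
                       (s≤s (urfather-ancestors-bound {s} (ancestry i-occurs) urfather))

    code-alphabet′ : ∀ {k} → OccursOn s′ k → All (_∈ codeAlphabet) (code′ k)
    code-alphabet′ o with occurs↓ o
    ... | inj₁ o′   = subst (All (_∈ codeAlphabet)) (sym (code′-old o′)) (code-alphabet o′)
    ... | inj₂ refl = subst (All (_∈ codeAlphabet)) (sym code′-j)
                        (∈-++⁺ʳ _ (⊑⇒∈subformulas ψ⊑φ) ∷ code-alphabet i-occurs)

    code-bounded′ : ∀ {k} → OccursOn s′ k → length (code′ k) ≤ maxCodeLength
    code-bounded′ o with occurs↓ o
    ... | inj₁ o′   = subst (λ c → length c ≤ maxCodeLength) (sym (code′-old o′)) (code-bounded o′)
    ... | inj₂ refl = code-bounded-j

    code-origin′ : ∀ {k} → OccursOn s′ k → CodeOrigin s′ code′ k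
    code-origin′ {k} o with occurs↓ o
    ... | inj₂ refl = inj₂ (ψ , i , code′-new , occurs↑ i-occurs , ∈-++⁺ʳ (used s) (here refl))
    ... | inj₁ o′ with code-origin o′
    ...   | inj₁ e = inj₁ (trans (code′-old o′) e)
    ...   | inj₂ (ψ′ , i′ , e , oi′ , u) = inj₂ (ψ′ , i′ , e′ , occurs↑ oi′ , ∈-++⁺ˡ u)
      where
        e′ : code′ k ≡ ψ′ ∷ code′ i′
        e′ = trans (code′-old o′) (trans e (cong (ψ′ ∷_) (sym (code′-old oi′))))

    code-edge′ : ∀ {k l} → (k , l) ∈ edges s′ → ∃[ ψ′ ] (code′ l ≡ ψ′ ∷ code′ k)
    code-edge′ e with ∈-++⁻ (edges s) e
    ... | inj₂ (here refl) = ψ , code′-new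
    ... | inj₁ e′ with code-edge e′ | edge-occurs e′
    ...   | ψ′ , eq | ok , ol =
            ψ′ , trans (code′-old ol) (trans eq (cong (ψ′ ∷_) (sym (code′-old ok))))

    ancestry-j : DistinctAncestors s′ j (length (code′ j))
    ancestry-j with ancestry i-occurs
    ... | xs , unique , ancestors , len =
          j ∷ xs , j∉xs ∷ unique , ε ∷ All.map extend ancestors , length-eq
      where
        j∉xs : All (j ≢_) xs
        j∉xs = All.map (λ { x≺*i refl → j-fresh (ancestor-occurs wf x≺*i i-occurs) }) ancestors
        extend : ∀ {x} → Star (_≺ₛ_ s) x i → Star (_≺ₛ_ s′) x j
        extend x≺*i = Star.map ∈-++⁺ˡ x≺*i ◅◅ new-edge ◅ ε
        length-eq : suc (length xs) ≡ length (code′ j)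
        length-eq = trans (cong suc len) (cong length (sym code′-j))

    ancestry′ : ∀ {k} → OccursOn s′ k → DistinctAncestors s′ k (length (code′ k))
    ancestry′ o with occurs↓ o
    ... | inj₂ refl = ancestry-j
    ... | inj₁ o′ with ancestry o′
    ...   | xs , unique , ancestors , len =
            xs , unique , All.map (Star.map ∈-++⁺ˡ) ancestors ,
            trans len (cong length (sym (code′-old o′)))

    wellFormed′ : WellFormed s′
    wellFormed′ = record
      { closure        = closure′
      ; edge-occurs    = edge-occurs′
      ; code           = code′
      ; code-alphabet  = code-alphabet′
      ; code-bounded   = code-bounded′
      ; code-origin    = code-origin′
      ; code-injective = code-injective′
      ; code-edge      = code-edge′
      ; ancestry       = ancestry′
      }

  step-preserves-WellFormed : ∀ {s s′} → WellFormed s → Step root s s′ → WellFormed s′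
  step-preserves-WellFormed wf (plain inst _ L∈alts) = PlainStep.wellFormed′ wf inst L∈alts
  step-preserves-WellFormed wf (dia (i◇ψ∈s , unused , ¬acc , urfather) j-fresh) =
    DiaStep.wellFormed′ wf i◇ψ∈s unused ¬acc urfather j-fresh

  nominalsOn : State → List Nom
  nominalsOn s = deduplicate ℕ._≟_ (concatMap mentioned (forms s))

  OccursOn⇒∈nominalsOn : ∀ {s k} → OccursOn s k → k ∈ nominalsOn s
  OccursOn⇒∈nominalsOn {s} o =
    ∈-deduplicate⁺ ℕ._≟_ (∈-concatMap⁺ mentioned (Any.map (Mentions⇒∈mentioned _) o))

  ∈nominalsOn⇒OccursOn : ∀ {s k} → k ∈ nominalsOn s → OccursOn s k
  ∈nominalsOn⇒OccursOn {s} k∈ =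
    Any.map (∈mentioned⇒Mentions _)
      (∈-concatMap⁻ mentioned (∈-deduplicate⁻ ℕ._≟_ (concatMap mentioned (forms s)) k∈))

  maxNominals : ℕ
  maxNominals = length (words maxCodeLength codeAlphabet)

  nominalsOn-bound : ∀ {s} → WellFormed s → length (nominalsOn s) ≤ maxNominals
  nominalsOn-bound {s} wf =
    pigeonhole code (UniqueDec.deduplicate-! ℕ._≟_ (concatMap mentioned (forms s)))
      (λ k∈ → let o = ∈nominalsOn⇒OccursOn {s} k∈ in
               ∈-words maxCodeLength (code-alphabet o) (code-bounded o))
      (λ j∈ k∈ → code-injective (∈nominalsOn⇒OccursOn {s} j∈) (∈nominalsOn⇒OccursOn {s} k∈))
    where open WellFormed wf

  nominalFormulas : Nom → List Form
  nominalFormulas k = nom k ∷ ~ ◇ nom k ∷ ~ nom k ∷ ◇ nom k ∷ []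

  closureFormulas : State → List Form
  closureFormulas s = quasiSubformulas ++ concatMap nominalFormulas (nominalsOn s)

  candidates : State → List TF
  candidates s = concatMap (λ k → map (k ,_) (closureFormulas s)) (nominalsOn s)

  forms⊆candidates : ∀ {s} → WellFormed s → forms s ⊆ candidates s
  forms⊆candidates {s} wf {k , χ} x∈ =
    ∈-concatMap⁺ (λ k → map (k ,_) (closureFormulas s))
      (lose (OccursOn⇒∈nominalsOn {s} (lose x∈ (inj₁ refl))) (∈-map⁺ (k ,_) (in-closure (closure x∈))))
    where
      open WellFormed wf
      nominal : ∀ {l χ′} → OccursIn l χ → χ′ ∈ nominalFormulas l → χ′ ∈ closureFormulas s
      nominal o χ′∈ = ∈-++⁺ʳ quasiSubformulas
        (∈-concatMap⁺ nominalFormulas (lose (OccursOn⇒∈nominalsOn {s} (lose x∈ (inj₂ o))) χ′∈))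
      in-closure : Closure (edges s) k χ → χ ∈ closureFormulas s
      in-closure (cl-sub p) = ∈-++⁺ˡ (QuasiSub⇒∈quasiSubformulas (inj₁ p))
      in-closure (cl-neg p) = ∈-++⁺ˡ (QuasiSub⇒∈quasiSubformulas (inj₂ (_ , refl , p)))
      in-closure cl-nom     = nominal o-nom (here refl)
      in-closure cl-¬◇      = nominal (o-~ (o-◇ o-nom)) (there (here refl))
      in-closure cl-¬nom    = nominal (o-~ o-nom) (there (there (here refl)))
      in-closure (cl-acc _) = nominal (o-◇ o-nom) (there (there (there (here refl))))

  maxForms : ℕ
  maxForms = maxNominals * (length quasiSubformulas + maxNominals * 4)

  candidates-bound : ∀ {s} → WellFormed s → length (candidates s) ≤ maxForms
  candidates-bound {s} wf = begin
    length (candidates s)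
      ≤⟨ length-concatMap≤ _ (nominalsOn s)
           (λ k → ℕ.≤-reflexive (List.length-map (k ,_) (closureFormulas s))) ⟩
    length (nominalsOn s) * length (closureFormulas s)
      ≤⟨ ℕ.*-mono-≤ (nominalsOn-bound wf) closureFormulas-bound ⟩
    maxForms ∎
    where
      open ℕ.≤-Reasoning
      closureFormulas-bound : length (closureFormulas s) ≤ length quasiSubformulas + maxNominals * 4
      closureFormulas-bound = begin
        length (closureFormulas s)
          ≡⟨ List.length-++ quasiSubformulas ⟩
        length quasiSubformulas + length (concatMap nominalFormulas (nominalsOn s))
          ≤⟨ ℕ.+-monoʳ-≤ _ (length-concatMap≤ nominalFormulas (nominalsOn s) (λ _ → ℕ.≤-refl)) ⟩
        length quasiSubformulas + length (nominalsOn s) * 4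
          ≤⟨ ℕ.+-monoʳ-≤ _ (ℕ.*-monoˡ-≤ 4 (nominalsOn-bound wf)) ⟩
        length quasiSubformulas + maxNominals * 4 ∎

  unique-forms-bound : ∀ {s xs} → WellFormed s → Unique xs → xs ⊆ forms s → length xs ≤ maxForms
  unique-forms-bound wf unique xs⊆ =
    ℕ.≤-trans (pigeonhole id unique (forms⊆candidates wf ∘ xs⊆) (λ _ _ → id)) (candidates-bound wf)

  module OnBranch (Θ : Branch root) where

    next-≼ : ∀ n → st Θ n ≼ st Θ (suc n)
    next-≼ n with next Θ n
    ... | inj₁ (_ , step) = step-≼ step
    ... | inj₂ (_ , eq)   = subst (st Θ n ≼_) (sym eq) ≼-refl

    stage-≼ : ∀ {m n} → m ≤ n → st Θ m ≼ st Θ n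
    stage-≼ = go ∘ ℕ.≤⇒≤′
      where
        go : ∀ {m n} → m ≤′ n → st Θ m ≼ st Θ n
        go ≤′-refl        = ≼-refl
        go (≤′-step m≤′n) = ≼-trans (go m≤′n) (next-≼ _)

    wellFormed : ∀ n → WellFormed (st Θ n)
    wellFormed zero = subst WellFormed (sym (start Θ)) wellFormed-init
    wellFormed (suc n) with next Θ n
    ... | inj₁ (_ , step) = step-preserves-WellFormed (wellFormed n) step
    ... | inj₂ (_ , eq)   = subst WellFormed (sym eq) (wellFormed n)

    unique-prefix : Infinite Θ → ∀ k → ∃[ n ] ∃[ xs ] (Unique xs × xs ⊆ forms (st Θ n) × length xs ≡ k)
    unique-prefix inf zero = 0 , [] , [] , (λ ()) , refl
    unique-prefix inf (suc k) with unique-prefix inf k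
    ... | n , xs , unique , xs⊆ , len with inf xs
    ...   | x , (m , x∈) , x∉xs = n ⊔ m , x ∷ xs , x∉xs′ ∷ unique , x∷xs⊆ , cong suc len
      where
        x∉xs′ : All (x ≢_) xs
        x∉xs′ = All.tabulate (λ { y∈ refl → x∉xs y∈ })
        x∷xs⊆ : x ∷ xs ⊆ forms (st Θ (n ⊔ m))
        x∷xs⊆ (here refl) = forms-⊆ (stage-≼ (ℕ.m≤n⊔m n m)) x∈
        x∷xs⊆ (there y∈)  = forms-⊆ (stage-≼ (ℕ.m≤m⊔n n m)) (xs⊆ y∈)

    ¬Infinite : ¬ Infinite Θ
    ¬Infinite inf with unique-prefix inf (suc maxForms)
    ... | n , xs , unique , xs⊆ , len =
          ℕ.<-irrefl refl (subst (_≤ maxForms) len (unique-forms-bound (wellFormed n) unique xs⊆))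

    chain-prefix : ((f , _) : InfiniteChain Θ) → ∀ k →
                   ∃[ n ] (∀ a → a < k → (f a , f (suc a)) ∈ edges (st Θ n))
    chain-prefix (f , f≺) zero = 0 , λ _ ()
    chain-prefix (f , f≺) (suc k) with chain-prefix (f , f≺) k | f≺ k
    ... | n , prefix | m , e = n ⊔ m , λ a a<1+k → edge a (ℕ.m≤n⇒m<n∨m≡n (ℕ.≤-pred a<1+k))
      where
        edge : ∀ a → a < k ⊎ a ≡ k → (f a , f (suc a)) ∈ edges (st Θ (n ⊔ m))
        edge a (inj₁ a<k)  = edges-⊆ (stage-≼ (ℕ.m≤m⊔n n m)) (prefix a a<k)
        edge a (inj₂ refl) = edges-⊆ (stage-≼ (ℕ.m≤n⊔m n m)) e

    ¬InfiniteChain : ¬ InfiniteChain Θ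
    ¬InfiniteChain (f , f≺) with chain-prefix (f , f≺) (suc maxCodeLength)
    ... | n , prefix =
          ℕ.<-irrefl refl (ℕ.≤-trans (code-grows maxCodeLength ℕ.≤-refl) (code-bounded f-occurs))
      where
        open WellFormed (wellFormed n)
        f-occurs : OccursOn (st Θ n) (f maxCodeLength)
        f-occurs = proj₁ (edge-occurs (prefix maxCodeLength ℕ.≤-refl))
        code-grows : ∀ a → a ≤ maxCodeLength → a < length (code (f a))
        code-grows zero    _     = code-nonempty (wellFormed n) (proj₁ (edge-occurs (prefix 0 (s≤s z≤n))))
        code-grows (suc a) a<max with code-edge (prefix a (ℕ.m<n⇒m<1+n a<max))
        ... | _ , e = subst (λ c → suc a < length c) (sym e) (s≤s (code-grows a (ℕ.<⇒≤ a<max)))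

-- The freshness of r is not needed: the branch is finite regardless.
lemma4 : ∀ (r : Nom) (φ : Form) → ¬ OccursIn r φ →
           (Θ : Branch (r , φ)) → Infinite Θ ⇔ InfiniteChain Θ
lemma4 r φ _ Θ = mk⇔ (⊥-elim ∘ ¬Infinite) (⊥-elim ∘ ¬InfiniteChain)
  where open Termination.OnBranch r φ Θ
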